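{- Let $n\geq 3$, $Y\cong\mathbb{Z}_4\times(\mathbb{Z}_2)^{n-2}$, let $W\cong(\mathbb{Z}_2)^3$ be a subgroup of $Y$, and let $P$ be a subset of $Y$ of cardinality $3$ with $\sum_{p\in P}p=0$, such that $W\cap\langle P\rangle=\{0\}$, where $\langle P\rangle$ is the subgroup generated by $P$. Then the set $W+P=\{w+p\colon w\in W,\,p\in P\}$ contains $8$ pairwise disjoint subsets, each of cardinality $3$ and each with sum $0$.
   Context: Groups are written additively. -}

module Defs where

open import Data.Nat using (ℕ; _∸_; _+_; _%_)
open import Data.Nat.DivMod using (m%n<n)
open import Data.Fin using (Fin; toℕ; fromℕ<; zero; suc)
open import Data.Bool using (Bool; false; true; _xor_)
open import Data.Vec using (Vec; zipWith; replicate)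
open import Data.Product using (_×_; _,_; Σ; ∃)
open import Relation.Binary.PropositionalEquality using (_≡_)

infixl 6 _+₄_ _⊕_ _+Y_
infix 8 -₄_ -Y_

_+₄_ : Fin 4 → Fin 4 → Fin 4
a +₄ b = fromℕ< (m%n<n (toℕ a + toℕ b) 4)

-₄_ : Fin 4 → Fin 4
-₄ zero = zero
-₄ suc zero = suc (suc (suc zero))
-₄ suc (suc zero) = suc (suc zero)
-₄ suc (suc (suc zero)) = suc zero

Z2^ : ℕ → Set
Z2^ k = Vec Bool k

_⊕_ : ∀ {k} → Z2^ k → Z2^ k → Z2^ k
_⊕_ = zipWith _xor_

-- Y = ℤ₄ × (ℤ₂)^(n-2)
-- (a record, so that n is recoverable from the type)
record Y (n : ℕ) : Set where
  constructor ⟪_,_⟫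
  field
    z4part : Fin 4
    z2part : Z2^ (n ∸ 2)

0Y : ∀ {n} → Y n
0Y = ⟪ zero , replicate _ false ⟫

_+Y_ : ∀ {n} → Y n → Y n → Y n
⟪ a , u ⟫ +Y ⟪ b , v ⟫ = ⟪ a +₄ b , u ⊕ v ⟫

-Y_ : ∀ {n} → Y n → Y n
-Y ⟪ a , u ⟫ = ⟪ -₄ a , u ⟫

data ⟨_⟩ {n : ℕ} (P : Y n → Set) : Y n → Set where
  gen  : ∀ {x} → P x → ⟨ P ⟩ x
  zer  : ⟨ P ⟩ 0Y
  add  : ∀ {x y} → ⟨ P ⟩ x → ⟨ P ⟩ y → ⟨ P ⟩ (x +Y y)
  neg  : ∀ {x} → ⟨ P ⟩ x → ⟨ P ⟩ (-Y x)

setOf : ∀ {n} → (Fin 3 → Y n) → Y n → Set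
setOf p x = ∃ λ j → x ≡ p j

IsHom : ∀ {n} → (Z2^ 3 → Y n) → Set
IsHom φ = ∀ a b → φ (a ⊕ b) ≡ φ a +Y φ b

Inj : ∀ {A B : Set} → (A → B) → Set
Inj f = ∀ a b → f a ≡ f b → a ≡ b

sum3 : ∀ {n} → (Fin 3 → Y n) → Y n
sum3 t = (t zero +Y t (suc zero)) +Y t (suc (suc zero))

-- Let L be the linear map of ℤ₂³ with L³ = 1 + L (minimal polynomial X³ + X + 1), so that 1, L
-- and 1 + L are all bijective. For w ∈ W the triple {w + p₀, Lw + p₁, (w + Lw) + p₂} sums to
-- 2(w + Lw) + Σ P = 0, as W has exponent 2. Since W ∩ ⟨P⟩ = 0, the map W × P → Y, (w, p) ↦ w + p
-- is injective: hence each triple has three elements, and triples for distinct w are disjoint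
-- because their j-th elements come from distinct points of W under the bijection 1, L or 1 + L.
module Submission where

open import Defs
open import Level using (0ℓ)
open import Algebra.Bundles using (AbelianGroup)
open import Algebra.Structures using (IsAbelianGroup)
open import Algebra.Consequences.Propositional using (comm∧idˡ⇒id; comm∧invʳ⇒inv)
import Algebra.Properties.AbelianGroup as AbelianGroupProperties
import Algebra.Properties.CommutativeSemigroup as CommutativeSemigroupProperties
open import Data.Nat using (ℕ; _≤_; _+_; _%_; NonZero)
open import Data.Nat.Properties using (+-assoc; +-comm)
open import Data.Nat.DivMod using (%-distribˡ-+; m%n%n≡m%n; m<n⇒m%n≡m)
open import Data.Fin using (Fin; zero; suc; toℕ)
open import Data.Fin.Properties using (toℕ-fromℕ<; toℕ-injective; toℕ<n)
open import Data.Bool using (false; true; _xor_)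
open import Data.Bool.Properties using (xor-assoc; xor-comm; xor-same; xor-identityʳ)
open import Data.Vec using ([]; _∷_; replicate)
open import Data.Product using (_×_; _,_; Σ; ∃; proj₁; proj₂)
open import Relation.Binary.PropositionalEquality
  using (_≡_; refl; sym; trans; cong; cong₂; subst; isEquivalence; module ≡-Reasoning)
open ≡-Reasoning

[m%d+n]%d≡[m+n]%d : ∀ m n d .{{_ : NonZero d}} → (m % d + n) % d ≡ (m + n) % d
[m%d+n]%d≡[m+n]%d m n d = begin
  (m % d + n) % d           ≡⟨ %-distribˡ-+ (m % d) n d ⟩
  (m % d % d + n % d) % d   ≡⟨ cong (λ k → (k + n % d) % d) (m%n%n≡m%n m d) ⟩
  (m % d + n % d) % d       ≡⟨ %-distribˡ-+ m n d ⟨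
  (m + n) % d               ∎

[m+n%d]%d≡[m+n]%d : ∀ m n d .{{_ : NonZero d}} → (m + n % d) % d ≡ (m + n) % d
[m+n%d]%d≡[m+n]%d m n d = begin
  (m + n % d) % d   ≡⟨ cong (_% d) (+-comm m (n % d)) ⟩
  (n % d + m) % d   ≡⟨ [m%d+n]%d≡[m+n]%d n m d ⟩
  (n + m) % d       ≡⟨ cong (_% d) (+-comm n m) ⟩
  (m + n) % d       ∎

toℕ-+₄ : ∀ a b → toℕ (a +₄ b) ≡ (toℕ a + toℕ b) % 4
toℕ-+₄ a b = toℕ-fromℕ< _

+₄-assoc : ∀ a b c → (a +₄ b) +₄ c ≡ a +₄ (b +₄ c)
+₄-assoc a b c = toℕ-injective (begin
  toℕ ((a +₄ b) +₄ c)          ≡⟨ toℕ-+₄ (a +₄ b) c ⟩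
  (toℕ (a +₄ b) + z) % 4       ≡⟨ cong (λ k → (k + z) % 4) (toℕ-+₄ a b) ⟩
  ((x + y) % 4 + z) % 4        ≡⟨ [m%d+n]%d≡[m+n]%d (x + y) z 4 ⟩
  (x + y + z) % 4              ≡⟨ cong (_% 4) (+-assoc x y z) ⟩
  (x + (y + z)) % 4            ≡⟨ [m+n%d]%d≡[m+n]%d x (y + z) 4 ⟨
  (x + (y + z) % 4) % 4        ≡⟨ cong (λ k → (x + k) % 4) (toℕ-+₄ b c) ⟨
  (x + toℕ (b +₄ c)) % 4       ≡⟨ toℕ-+₄ a (b +₄ c) ⟨
  toℕ (a +₄ (b +₄ c))          ∎)
  where
  x = toℕ a
  y = toℕ b
  z = toℕ c

+₄-comm : ∀ a b → a +₄ b ≡ b +₄ a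
+₄-comm a b = toℕ-injective (begin
  toℕ (a +₄ b)          ≡⟨ toℕ-+₄ a b ⟩
  (toℕ a + toℕ b) % 4   ≡⟨ cong (_% 4) (+-comm (toℕ a) (toℕ b)) ⟩
  (toℕ b + toℕ a) % 4   ≡⟨ toℕ-+₄ b a ⟨
  toℕ (b +₄ a)          ∎)

+₄-identityˡ : ∀ a → zero +₄ a ≡ a
+₄-identityˡ a = toℕ-injective (trans (toℕ-+₄ zero a) (m<n⇒m%n≡m (toℕ<n a)))

+₄-inverseʳ : ∀ a → a +₄ (-₄ a) ≡ zero
+₄-inverseʳ zero                   = refl
+₄-inverseʳ (suc zero)             = refl
+₄-inverseʳ (suc (suc zero))       = refl
+₄-inverseʳ (suc (suc (suc zero))) = refl

⊕-assoc : ∀ {k} (u v w : Z2^ k) → (u ⊕ v) ⊕ w ≡ u ⊕ (v ⊕ w)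
⊕-assoc []      []      []      = refl
⊕-assoc (x ∷ u) (y ∷ v) (z ∷ w) = cong₂ _∷_ (xor-assoc x y z) (⊕-assoc u v w)

⊕-comm : ∀ {k} (u v : Z2^ k) → u ⊕ v ≡ v ⊕ u
⊕-comm []      []      = refl
⊕-comm (x ∷ u) (y ∷ v) = cong₂ _∷_ (xor-comm x y) (⊕-comm u v)

⊕-identityˡ : ∀ {k} (u : Z2^ k) → replicate k false ⊕ u ≡ u
⊕-identityˡ []      = refl
⊕-identityˡ (x ∷ u) = cong (x ∷_) (⊕-identityˡ u)

⊕-self : ∀ {k} (u : Z2^ k) → u ⊕ u ≡ replicate k false
⊕-self []      = refl
⊕-self (x ∷ u) = cong₂ _∷_ (xor-same x) (⊕-self u)

module _ {n : ℕ} where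

  +Y-assoc : (x y z : Y n) → (x +Y y) +Y z ≡ x +Y (y +Y z)
  +Y-assoc ⟪ a , u ⟫ ⟪ b , v ⟫ ⟪ c , w ⟫ = cong₂ ⟪_,_⟫ (+₄-assoc a b c) (⊕-assoc u v w)

  +Y-comm : (x y : Y n) → x +Y y ≡ y +Y x
  +Y-comm ⟪ a , u ⟫ ⟪ b , v ⟫ = cong₂ ⟪_,_⟫ (+₄-comm a b) (⊕-comm u v)

  +Y-identityˡ : (x : Y n) → 0Y +Y x ≡ x
  +Y-identityˡ ⟪ a , u ⟫ = cong₂ ⟪_,_⟫ (+₄-identityˡ a) (⊕-identityˡ u)

  +Y-inverseʳ : (x : Y n) → x +Y (-Y x) ≡ 0Y
  +Y-inverseʳ ⟪ a , u ⟫ = cong₂ ⟪_,_⟫ (+₄-inverseʳ a) (⊕-self u)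

Y-isAbelianGroup : ∀ n → IsAbelianGroup {A = Y n} _≡_ _+Y_ 0Y -Y_
Y-isAbelianGroup n = record
  { isGroup = record
    { isMonoid = record
      { isSemigroup = record
        { isMagma = record { isEquivalence = isEquivalence ; ∙-cong = cong₂ _+Y_ }
        ; assoc   = +Y-assoc
        }
      ; identity = comm∧idˡ⇒id +Y-comm +Y-identityˡ
      }
    ; inverse = comm∧invʳ⇒inv +Y-comm +Y-inverseʳ
    ; ⁻¹-cong = cong -Y_
    }
  ; comm = +Y-comm
  }

Y-abelianGroup : ℕ → AbelianGroup 0ℓ 0ℓ
Y-abelianGroup n = record { isAbelianGroup = Y-isAbelianGroup n }

L : Z2^ 3 → Z2^ 3
L (x₀ ∷ x₁ ∷ x₂ ∷ []) = x₂ ∷ (x₀ xor x₂) ∷ x₁ ∷ []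

L⁻¹ : Z2^ 3 → Z2^ 3
L⁻¹ (y₀ ∷ y₁ ∷ y₂ ∷ []) = (y₁ xor y₀) ∷ y₂ ∷ y₀ ∷ []

L⁻¹∘L≗id : ∀ x → L⁻¹ (L x) ≡ x
L⁻¹∘L≗id (x₀ ∷ x₁ ∷ x₂ ∷ []) = cong (_∷ x₁ ∷ x₂ ∷ []) (begin
  (x₀ xor x₂) xor x₂   ≡⟨ xor-assoc x₀ x₂ x₂ ⟩
  x₀ xor (x₂ xor x₂)   ≡⟨ cong (x₀ xor_) (xor-same x₂) ⟩
  x₀ xor false         ≡⟨ xor-identityʳ x₀ ⟩
  x₀                   ∎)

L-injective : Inj L
L-injective x y eq = trans (sym (L⁻¹∘L≗id x)) (trans (cong L⁻¹ eq) (L⁻¹∘L≗id y))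

L³≗1+L : ∀ x → L (L (L x)) ≡ x ⊕ L x
L³≗1+L (x₀ ∷ x₁ ∷ x₂ ∷ []) = refl

wPart : Fin 3 → Z2^ 3 → Z2^ 3
wPart zero             x = x
wPart (suc zero)       x = L x
wPart (suc (suc zero)) x = x ⊕ L x

wPart-injective : ∀ j → Inj (wPart j)
wPart-injective zero             x y eq = eq
wPart-injective (suc zero)       x y eq = L-injective x y eq
wPart-injective (suc (suc zero)) x y eq =
  L-injective _ _ (L-injective _ _ (L-injective _ _ (trans (L³≗1+L x) (trans eq (sym (L³≗1+L y))))))

bits : Fin 8 → Z2^ 3
bits zero                                           = false ∷ false ∷ false ∷ []
bits (suc zero)                                     = false ∷ false ∷ true  ∷ []
bits (suc (suc zero))                               = false ∷ true  ∷ false ∷ []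
bits (suc (suc (suc zero)))                         = false ∷ true  ∷ true  ∷ []
bits (suc (suc (suc (suc zero))))                   = true  ∷ false ∷ false ∷ []
bits (suc (suc (suc (suc (suc zero)))))             = true  ∷ false ∷ true  ∷ []
bits (suc (suc (suc (suc (suc (suc zero))))))       = true  ∷ true  ∷ false ∷ []
bits (suc (suc (suc (suc (suc (suc (suc zero))))))) = true  ∷ true  ∷ true  ∷ []

fromBits : Z2^ 3 → Fin 8
fromBits (false ∷ false ∷ false ∷ []) = zero
fromBits (false ∷ false ∷ true  ∷ []) = suc zero
fromBits (false ∷ true  ∷ false ∷ []) = suc (suc zero)
fromBits (false ∷ true  ∷ true  ∷ []) = suc (suc (suc zero))
fromBits (true  ∷ false ∷ false ∷ []) = suc (suc (suc (suc zero)))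
fromBits (true  ∷ false ∷ true  ∷ []) = suc (suc (suc (suc (suc zero))))
fromBits (true  ∷ true  ∷ false ∷ []) = suc (suc (suc (suc (suc (suc zero)))))
fromBits (true  ∷ true  ∷ true  ∷ []) = suc (suc (suc (suc (suc (suc (suc zero))))))

fromBits∘bits≗id : ∀ i → fromBits (bits i) ≡ i
fromBits∘bits≗id zero                                          = refl
fromBits∘bits≗id (suc zero)                                    = refl
fromBits∘bits≗id (suc (suc zero))                              = refl
fromBits∘bits≗id (suc (suc (suc zero)))                        = refl
fromBits∘bits≗id (suc (suc (suc (suc zero))))                  = refl
fromBits∘bits≗id (suc (suc (suc (suc (suc zero)))))            = refl
fromBits∘bits≗id (suc (suc (suc (suc (suc (suc zero))))))      = refl
fromBits∘bits≗id (suc (suc (suc (suc (suc (suc (suc zero))))))) = refl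

bits-injective : Inj bits
bits-injective i i′ eq =
  trans (sym (fromBits∘bits≗id i)) (trans (cong fromBits eq) (fromBits∘bits≗id i′))

block : ∀ {n} → (Z2^ 3 → Y n) → (Fin 3 → Y n) → Z2^ 3 → Fin 3 → Y n
block φ p w j = φ (wPart j w) +Y p j

module _ {n : ℕ} where
  open AbelianGroup (Y-abelianGroup n) using (commutativeSemigroup)
  open AbelianGroupProperties (Y-abelianGroup n)
  open CommutativeSemigroupProperties commutativeSemigroup using (interchange)

  sum3-+Y : (s t : Fin 3 → Y n) → sum3 (λ j → s j +Y t j) ≡ sum3 s +Y sum3 t
  sum3-+Y s t = begin
    (s₀ +Y t₀) +Y (s₁ +Y t₁) +Y (s₂ +Y t₂)   ≡⟨ cong (_+Y (s₂ +Y t₂)) (interchange s₀ t₀ s₁ t₁) ⟩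
    (s₀ +Y s₁) +Y (t₀ +Y t₁) +Y (s₂ +Y t₂)   ≡⟨ interchange (s₀ +Y s₁) (t₀ +Y t₁) s₂ t₂ ⟩
    sum3 s +Y sum3 t                          ∎
    where
    s₀ = s zero ; s₁ = s (suc zero) ; s₂ = s (suc (suc zero))
    t₀ = t zero ; t₁ = t (suc zero) ; t₂ = t (suc (suc zero))

  module _ (φ : Z2^ 3 → Y n) (hom : IsHom φ) where

    homo-ε : φ (replicate 3 false) ≡ 0Y
    homo-ε = identityʳ-unique _ _ (sym (hom (replicate 3 false) (replicate 3 false)))

    homo-double : ∀ a → φ a +Y φ a ≡ 0Y
    homo-double a = begin
      φ a +Y φ a              ≡⟨ hom a a ⟨
      φ (a ⊕ a)               ≡⟨ cong φ (⊕-self a) ⟩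
      φ (replicate 3 false)   ≡⟨ homo-ε ⟩
      0Y                      ∎

    homo-self-inverse : ∀ a → φ a ≡ -Y φ a
    homo-self-inverse a = inverseˡ-unique (φ a) (φ a) (homo-double a)

    homo-sum3 : ∀ a b → (φ a +Y φ b) +Y φ (a ⊕ b) ≡ 0Y
    homo-sum3 a b = trans (cong (_+Y φ (a ⊕ b)) (sym (hom a b))) (homo-double (a ⊕ b))

    sum3-block : (p : Fin 3 → Y n) → sum3 p ≡ 0Y → ∀ w → sum3 (block φ p w) ≡ 0Y
    sum3-block p sum-p w = begin
      sum3 (block φ p w)                       ≡⟨ sum3-+Y (λ j → φ (wPart j w)) p ⟩
      sum3 (λ j → φ (wPart j w)) +Y sum3 p     ≡⟨ cong₂ _+Y_ (homo-sum3 w (L w)) sum-p ⟩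
      0Y +Y 0Y                                 ≡⟨ +Y-identityˡ 0Y ⟩
      0Y                                       ∎

    module _ (p : Fin 3 → Y n)
             (W∩⟨P⟩≡0 : ∀ x → (∃ λ a → x ≡ φ a) → ⟨ setOf p ⟩ x → x ≡ 0Y) where

      W+P-unique : ∀ {a a′ k k′} → φ a +Y p k ≡ φ a′ +Y p k′ → φ a ≡ φ a′ × p k ≡ p k′
      W+P-unique {a} {a′} {k} {k′} eq =
        φa≡φa′ , ∙-cancelˡ (φ a) (p k) (p k′) (trans eq (cong (_+Y p k′) (sym φa≡φa′)))
        where
        shift : (φ a′ +Y φ a) +Y p k ≡ p k′
        shift = begin
          (φ a′ +Y φ a) +Y p k     ≡⟨ +Y-assoc (φ a′) (φ a) (p k) ⟩
          φ a′ +Y (φ a +Y p k)     ≡⟨ cong (φ a′ +Y_) eq ⟩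
          φ a′ +Y (φ a′ +Y p k′)   ≡⟨ +Y-assoc (φ a′) (φ a′) (p k′) ⟨
          (φ a′ +Y φ a′) +Y p k′   ≡⟨ cong (_+Y p k′) (homo-double a′) ⟩
          0Y +Y p k′               ≡⟨ +Y-identityˡ (p k′) ⟩
          p k′                     ∎

        difference∈⟨P⟩ : ⟨ setOf p ⟩ (φ a′ +Y φ a)
        difference∈⟨P⟩ =
          subst ⟨ setOf p ⟩ (sym (x≈z//y _ _ _ shift)) (add (gen (k′ , refl)) (neg (gen (k , refl))))

        φa≡φa′ : φ a ≡ φ a′
        φa≡φa′ = begin
          φ a       ≡⟨ inverseʳ-unique (φ a′) (φ a) (W∩⟨P⟩≡0 _ (a′ ⊕ a , sym (hom a′ a)) difference∈⟨P⟩) ⟩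
          -Y φ a′   ≡⟨ homo-self-inverse a′ ⟨
          φ a′      ∎

      block-injective : Inj p → ∀ w → Inj (block φ p w)
      block-injective injp w j j′ eq = injp j j′ (proj₂ (W+P-unique eq))

      blocks-disjoint : Inj φ → Inj p → ∀ w w′ j j′ → block φ p w j ≡ block φ p w′ j′ → w ≡ w′
      blocks-disjoint injφ injp w w′ j j′ eq with injp j j′ (proj₂ (W+P-unique eq))
      ... | refl = wPart-injective j w w′ (injφ _ _ (proj₁ (W+P-unique eq)))

mainTheorem4 : (n : ℕ) → 3 ≤ n →
    (φ : Z2^ 3 → Y n) → IsHom φ → Inj φ →
    (p : Fin 3 → Y n) → Inj p → sum3 p ≡ 0Y →
    (∀ x → (∃ λ a → x ≡ φ a) → ⟨ setOf p ⟩ x → x ≡ 0Y) →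
    Σ (Fin 8 → Fin 3 → Y n) λ T →
      (∀ i → Inj (T i)) ×
      (∀ i → sum3 (T i) ≡ 0Y) ×
      (∀ i j → ∃ λ a → ∃ λ k → T i j ≡ φ a +Y p k) ×
      (∀ i i′ j j′ → T i j ≡ T i′ j′ → i ≡ i′)
mainTheorem4 n _ φ hom injφ p injp sum-p W∩⟨P⟩≡0 =
  (λ i → block φ p (bits i)) ,
  (λ i → block-injective φ hom p W∩⟨P⟩≡0 injp (bits i)) ,
  (λ i → sum3-block φ hom p sum-p (bits i)) ,
  (λ i j → wPart j (bits i) , j , refl) ,
  (λ i i′ j j′ eq →
     bits-injective i i′ (blocks-disjoint φ hom p W∩⟨P⟩≡0 injφ injp (bits i) (bits i′) j j′ eq))
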